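{- For each positive integer $n$, there are exactly $n$ pairwise non-isomorphic $\mathbf{I}_{2,0}$-chains of size $n$.
   Context: A zroupoid is an algebra $\mathbf A=\langle A,\to,0\rangle$ with a binary operation $\to$ and a constant $0$; write $x':=x\to 0$. An implication zroupoid is a zroupoid satisfying (I) $(x\to y)\to z\approx[(z'\to x)\to(y\to z)']'$ and $0''\approx 0$. $\mathbf{I}_{2,0}$ is the variety of implication zroupoids additionally satisfying $x''\approx x$. For such an algebra define $x\sqsubseteq y$ iff $(x\to y')'=x$ (this is a partial order on members of $\mathbf{I}_{2,0}$). An $\mathbf{I}_{2,0}$-chain is an algebra $\mathbf A\in\mathbf{I}_{2,0}$ on which $\sqsubseteq$ is a total order. Isomorphism means isomorphism of algebras $\langle A,\to,0\rangle$. -}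

module Defs where

open import Level using (0ℓ)
open import Data.Sum using (_⊎_)
open import Data.Product using (_×_)
open import Relation.Binary.PropositionalEquality using (_≡_)
open import Function.Bundles using (_↔_; Inverse)

record Zroupoid : Set₁ where
  field
    Carrier : Set
    _⇒_     : Carrier → Carrier → Carrier
    𝟎       : Carrier

  _′ : Carrier → Carrier
  x ′ = x ⇒ 𝟎

  infixr 5 _⇒_
  infixl 8 _′

  _⊑_ : Carrier → Carrier → Set
  x ⊑ y = ((x ⇒ (y ′)) ′) ≡ x

open Zroupoid public using (Carrier)

record IsImplicationZroupoid (A : Zroupoid) : Set where
  open Zroupoid A
  field
    identityI : ∀ x y z →
      ((x ⇒ y) ⇒ z) ≡ (((z ′) ⇒ x) ⇒ ((y ⇒ z) ′)) ′
    zero′′ : (𝟎 ′) ′ ≡ 𝟎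

record IsI₂₀ (A : Zroupoid) : Set where
  open Zroupoid A
  field
    isImplicationZroupoid : IsImplicationZroupoid A
    involution : ∀ x → (x ′) ′ ≡ x

record IsI₂₀Chain (A : Zroupoid) : Set where
  open Zroupoid A
  field
    isI₂₀ : IsI₂₀ A
    total : ∀ x y → (x ⊑ y) ⊎ (y ⊑ x)

record _≅_ (A B : Zroupoid) : Set where
  field
    bij : Carrier A ↔ Carrier B
  open Inverse bij public using (to; from)
  field
    hom-⇒ : ∀ x y → to (Zroupoid._⇒_ A x y) ≡ Zroupoid._⇒_ B (to x) (to y)
    hom-𝟎 : to (Zroupoid.𝟎 A) ≡ Zroupoid.𝟎 B

module Submission where

-- For 0 ≤ m ≤ N let g be the map on {0,…,N} that fixes every k < m and reflects
-- the interval [m, N] (k ↦ m + (N ∸ k)).  The standard chain C(N, m) has carrier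
-- Fin (suc N), constant 0 := m and x → y := g (x ⊓ g y); it is an I₂₀-chain
-- whose order ⊑ is the usual order and whose negation x ↦ x′ is g.
--
-- Conversely, in any I₂₀-chain A the operation x ∧ y := (x → y′)′ is commutative
-- and selective (an equational consequence of (I) and x″ = x), ⊑ is a total
-- order, and ′ fixes every element strictly below 0 while it reverses the order
-- on the up-set of 0.  When A has N + 1 elements, ranking its elements along ⊑
-- identifies A with Fin (suc N); ∧ becomes ⊓, and ′ becomes a strictly decreasing
-- self-map of [rank 0, N], which must be the reflection.  So A ≅ C(N, rank 0).
-- Finally an isomorphism C(N, m) ≅ C(N, m′) is a strictly increasing self-map of
-- {0,…,N}, hence the identity, which forces m = m′.

open import Defs hiding (Carrier)
open Defs using (Carrier)
open import Data.Nat
  using (ℕ; zero; suc; NonZero; _+_; _∸_; _⊓_; _≤_; _<_; _<?_; s≤s; s≤s⁻¹)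
open import Data.Nat.Properties
open import Data.Nat.DivMod using (_mod_; m<n⇒m%n≡m)
open import Data.Fin using (Fin; toℕ; punchOut)
open import Data.Fin.Properties
  using (toℕ-injective; toℕ-fromℕ<; toℕ≤pred[n]; any?; punchOut-injective; injective⇒≤)
  renaming (_≟_ to _≟ᶠ_)
open import Data.Fin.Subset using (Subset; _∈_; ∣_∣)
open import Data.Fin.Subset.Properties using (p⊂q⇒∣p∣<∣q∣; ∈⊤; ⊆⊤; ∣⊤∣≡n)
open import Data.Vec using (tabulate; lookup)
open import Data.Vec.Properties using (lookup∘tabulate; []=⇒lookup; lookup⇒[]=)
open import Data.Bool.Properties using (T-≡)
open import Data.Product using (Σ; ∃; _×_; _,_; proj₁; proj₂)
open import Data.Sum using (_⊎_; inj₁; inj₂) renaming (map to ⊎-map)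
open import Data.Empty using (⊥-elim)
open import Relation.Nullary using (¬_; Dec; yes; no; isYes)
open import Relation.Nullary.Decidable using (toWitness; fromWitness; map′; ¬?; _×-dec_)
open import Relation.Binary.PropositionalEquality
open import Function.Bundles using (_↔_; Inverse; Injection; Equivalence; mk↔ₛ′)
open import Function.Properties.Inverse using (↔⇒↣)
open import Function.Construct.Identity using (↔-id)

-- Strictly monotone maps on an interval of ℕ.

module _ (h : ℕ → ℕ) where

  increasing-accumulates : ∀ {a b} → (∀ k → a ≤ k → k < b → h k < h (suc k)) →
                           ∀ d → a + d ≤ b → h a + d ≤ h (a + d)
  increasing-accumulates {a} inc zero _
    rewrite +-identityʳ a | +-identityʳ (h a) = ≤-refl
  increasing-accumulates {a} {b} inc (suc d) a+1+d≤b = begin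
      h a + suc d      ≡⟨ +-suc (h a) d ⟩
      suc (h a + d)    ≤⟨ s≤s (increasing-accumulates inc d (<⇒≤ a+d<b)) ⟩
      suc (h (a + d))  ≤⟨ inc (a + d) (m≤m+n a d) a+d<b ⟩
      h (suc (a + d))  ≡⟨ cong h (+-suc a d) ⟨
      h (a + suc d)    ∎
    where
      open ≤-Reasoning
      a+d<b : a + d < b
      a+d<b = subst (_≤ b) (+-suc a d) a+1+d≤b

  decreasing-accumulates : ∀ {a b} → (∀ k → a ≤ k → k < b → h (suc k) < h k) →
                           ∀ d → a + d ≤ b → h (a + d) + d ≤ h a
  decreasing-accumulates {a} dec zero _
    rewrite +-identityʳ a | +-identityʳ (h a) = ≤-refl
  decreasing-accumulates {a} {b} dec (suc d) a+1+d≤b = begin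
      h (a + suc d) + suc d      ≡⟨ cong (λ j → h j + suc d) (+-suc a d) ⟩
      h (suc (a + d)) + suc d    ≡⟨ +-suc (h (suc (a + d))) d ⟩
      suc (h (suc (a + d))) + d  ≤⟨ +-monoˡ-≤ d (dec (a + d) (m≤m+n a d) a+d<b) ⟩
      h (a + d) + d              ≤⟨ decreasing-accumulates dec d (<⇒≤ a+d<b) ⟩
      h a                        ∎
    where
      open ≤-Reasoning
      a+d<b : a + d < b
      a+d<b = subst (_≤ b) (+-suc a d) a+1+d≤b

increasing-self-map-is-id : ∀ {N} (h : ℕ → ℕ) → (∀ k → k < N → h k < h (suc k)) →
                            (∀ k → k ≤ N → h k ≤ N) → ∀ k → k ≤ N → h k ≡ k
increasing-self-map-is-id {N} h inc bounded k k≤N = ≤-antisym upper lower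
  where
    open ≤-Reasoning
    k+[N∸k]≡N : k + (N ∸ k) ≡ N
    k+[N∸k]≡N = m+[n∸m]≡n k≤N
    lower : k ≤ h k
    lower = ≤-trans (m≤n+m k (h 0)) (increasing-accumulates h (λ j _ → inc j) k k≤N)
    upper : h k ≤ k
    upper = +-cancelʳ-≤ (N ∸ k) (h k) k (begin
      h k + (N ∸ k)  ≤⟨ increasing-accumulates h (λ j _ → inc j) (N ∸ k) (≤-reflexive k+[N∸k]≡N) ⟩
      h (k + (N ∸ k)) ≡⟨ cong h k+[N∸k]≡N ⟩
      h N             ≤⟨ bounded N ≤-refl ⟩
      N               ≡⟨ k+[N∸k]≡N ⟨
      k + (N ∸ k)     ∎)

decreasing-self-map-is-reflection :
  ∀ {m N} (h : ℕ → ℕ) → (∀ k → m ≤ k → k < N → h (suc k) < h k) →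
  (∀ k → m ≤ k → k ≤ N → m ≤ h k × h k ≤ N) →
  ∀ k → m ≤ k → k ≤ N → h k ≡ m + (N ∸ k)
decreasing-self-map-is-reflection {m} {N} h dec range k m≤k k≤N = ≤-antisym upper lower
  where
    open ≤-Reasoning
    m≤N : m ≤ N
    m≤N = ≤-trans m≤k k≤N
    k+[N∸k]≡N : k + (N ∸ k) ≡ N
    k+[N∸k]≡N = m+[n∸m]≡n k≤N
    m+[k∸m]≡k : m + (k ∸ m) ≡ k
    m+[k∸m]≡k = m+[n∸m]≡n m≤k
    lower : m + (N ∸ k) ≤ h k
    lower = begin
      m + (N ∸ k)            ≤⟨ +-monoˡ-≤ (N ∸ k) (proj₁ (range N m≤N ≤-refl)) ⟩
      h N + (N ∸ k)          ≡⟨ cong (λ j → h j + (N ∸ k)) k+[N∸k]≡N ⟨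
      h (k + (N ∸ k)) + (N ∸ k) ≤⟨ decreasing-accumulates h (λ j k≤j → dec j (≤-trans m≤k k≤j))
                                     (N ∸ k) (≤-reflexive k+[N∸k]≡N) ⟩
      h k                    ∎
    total-length : m + (N ∸ k) + (k ∸ m) ≡ N
    total-length = begin-equality
      m + (N ∸ k) + (k ∸ m)   ≡⟨ cong (_+ (k ∸ m)) (+-comm m (N ∸ k)) ⟩
      (N ∸ k) + m + (k ∸ m)   ≡⟨ +-assoc (N ∸ k) m (k ∸ m) ⟩
      (N ∸ k) + (m + (k ∸ m)) ≡⟨ cong ((N ∸ k) +_) m+[k∸m]≡k ⟩
      (N ∸ k) + k             ≡⟨ m∸n+n≡m k≤N ⟩
      N                       ∎
    upper : h k ≤ m + (N ∸ k)
    upper = +-cancelʳ-≤ (k ∸ m) (h k) (m + (N ∸ k)) (begin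
      h k + (k ∸ m)              ≡⟨ cong (λ j → h j + (k ∸ m)) m+[k∸m]≡k ⟨
      h (m + (k ∸ m)) + (k ∸ m)  ≤⟨ decreasing-accumulates h dec (k ∸ m)
                                      (≤-trans (≤-reflexive m+[k∸m]≡k) k≤N) ⟩
      h m                        ≤⟨ proj₂ (range m ≤-refl m≤N) ⟩
      N                          ≡⟨ total-length ⟨
      m + (N ∸ k) + (k ∸ m)      ∎)

toℕ-mod : ∀ {N k} → k ≤ N → toℕ (k mod suc N) ≡ k
toℕ-mod k≤N = trans (toℕ-fromℕ< _) (m<n⇒m%n≡m (s≤s k≤N))

injective⇒surjective : ∀ {n} (f : Fin n → Fin n) → (∀ {x y} → f x ≡ f y → x ≡ y) →
                       ∀ y → ∃ λ x → f x ≡ y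
injective⇒surjective {suc n} f f-injective y with any? (λ x → f x ≟ᶠ y)
... | yes hit = hit
... | no miss = ⊥-elim (1+n≰n (injective⇒≤ {f = squeeze} squeeze-injective))
  where
    avoids : ∀ x → y ≢ f x
    avoids x eq = miss (x , sym eq)
    -- without a preimage of y, f squeezes Fin (suc n) injectively into Fin n
    squeeze : Fin (suc n) → Fin n
    squeeze x = punchOut (avoids x)
    squeeze-injective : ∀ {x z} → squeeze x ≡ squeeze z → x ≡ z
    squeeze-injective {x} {z} eq = f-injective (punchOut-injective (avoids x) (avoids z) eq)

-- Equational consequences of (I) and x″ = x.

module I₂₀-Laws (A : Zroupoid) (isI₂₀ : IsI₂₀ A) where
  open Zroupoid A hiding (Carrier)
  open IsI₂₀ isI₂₀ using (involution; isImplicationZroupoid)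
  open IsImplicationZroupoid isImplicationZroupoid using (identityI)
  open ≡-Reasoning

  𝟏 : Carrier A
  𝟏 = 𝟎 ′

  -- The meet; by definition x ⊑ y is exactly x ∧ y ≡ x.
  infixl 7 _∧_
  _∧_ : Carrier A → Carrier A → Carrier A
  x ∧ y = (x ⇒ y ′) ′

  ′-injective : ∀ {x y} → x ′ ≡ y ′ → x ≡ y
  ′-injective {x} {y} eq = trans (sym (involution x)) (trans (cong _′ eq) (involution y))

  ⇒-via-∧ : ∀ x y → x ⇒ y ≡ (x ∧ y ′) ′
  ⇒-via-∧ x y = trans (cong (x ⇒_) (sym (involution y))) (sym (involution (x ⇒ y ′ ′)))

  𝟏-⇒ : ∀ x → 𝟏 ⇒ x ≡ x
  𝟏-⇒ x = begin
    𝟏 ⇒ x              ≡⟨ involution (𝟏 ⇒ x) ⟨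
    (𝟏 ⇒ x) ′ ′        ≡⟨ cong (λ w → ((𝟏 ⇒ x) ⇒ w) ′) (involution 𝟎) ⟨
    ((𝟏 ⇒ x) ⇒ 𝟏 ′) ′  ≡⟨ identityI x 𝟎 𝟎 ⟨
    x ′ ′              ≡⟨ involution x ⟩
    x                  ∎

  𝟎-⇒-⇒ : ∀ y z → (𝟎 ⇒ y) ⇒ z ≡ (z ⇒ (y ⇒ z) ′) ′
  𝟎-⇒-⇒ y z = trans (identityI 𝟎 y z) (cong (λ w → (w ⇒ (y ⇒ z) ′) ′) (involution z))

  ′-via-𝟎 : ∀ x → x ′ ≡ x ⇒ (𝟎 ⇒ x) ′
  ′-via-𝟎 x = begin
    x ′                    ≡⟨ cong _′ (trans (sym (𝟏-⇒ x)) (𝟎-⇒-⇒ 𝟎 x)) ⟩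
    (x ⇒ (𝟎 ⇒ x) ′) ′ ′    ≡⟨ involution _ ⟩
    x ⇒ (𝟎 ⇒ x) ′          ∎

  𝟎-⇒-𝟏 : 𝟎 ⇒ 𝟏 ≡ 𝟏
  𝟎-⇒-𝟏 = ′-injective (sym (trans (′-via-𝟎 𝟏) (𝟏-⇒ _)))

  ∧-idempotent : ∀ x → x ∧ x ≡ x
  ∧-idempotent x = sym (begin
    x                   ≡⟨ 𝟏-⇒ x ⟨
    𝟏 ⇒ x               ≡⟨ cong (_⇒ x) 𝟎-⇒-𝟏 ⟨
    (𝟎 ⇒ 𝟏) ⇒ x         ≡⟨ 𝟎-⇒-⇒ 𝟏 x ⟩
    (x ⇒ (𝟏 ⇒ x) ′) ′   ≡⟨ cong (λ w → (x ⇒ w ′) ′) (𝟏-⇒ x) ⟩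
    (x ⇒ x ′) ′         ∎)

  ∧-𝟏 : ∀ x → x ∧ 𝟏 ≡ x
  ∧-𝟏 x = trans (cong (λ w → (x ⇒ w) ′) (involution 𝟎)) (involution x)

  -- The key law behind commutativity in chains: x ⊑ y implies y ∧ x ≡ x.
  ∧-swap : ∀ {x y} → x ∧ y ≡ x → y ∧ x ≡ x
  ∧-swap {x} {y} x∧y≡x = begin
    (y ⇒ x ′) ′                        ≡⟨ cong (λ w → (w ⇒ x ′) ′) (involution y) ⟨
    ((y ′ ⇒ 𝟎) ⇒ x ′) ′                ≡⟨ cong _′ (identityI (y ′) 𝟎 (x ′)) ⟩
    ((x ′ ′ ⇒ y ′) ⇒ (𝟎 ⇒ x ′) ′) ′ ′  ≡⟨ involution _ ⟩
    (x ′ ′ ⇒ y ′) ⇒ (𝟎 ⇒ x ′) ′        ≡⟨ cong (λ w → (w ⇒ y ′) ⇒ (𝟎 ⇒ x ′) ′) (involution x) ⟩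
    (x ⇒ y ′) ⇒ (𝟎 ⇒ x ′) ′            ≡⟨ cong (λ w → w ⇒ (𝟎 ⇒ x ′) ′) x⇒y′≡x′ ⟩
    x ′ ⇒ (𝟎 ⇒ x ′) ′                  ≡⟨ ′-via-𝟎 (x ′) ⟨
    x ′ ′                              ≡⟨ involution x ⟩
    x                                  ∎
    where
      x⇒y′≡x′ : x ⇒ y ′ ≡ x ′
      x⇒y′≡x′ = trans (sym (involution _)) (cong _′ x∧y≡x)

  𝟏-∧ : ∀ x → 𝟏 ∧ x ≡ x
  𝟏-∧ x = ∧-swap (∧-𝟏 x)

  ⇒-∧ : ∀ p q z → (p ⇒ q) ∧ z ≡ (z ⇒ p) ⇒ (q ∧ z)
  ⇒-∧ p q z = begin
    ((p ⇒ q) ⇒ z ′) ′                   ≡⟨ cong _′ (identityI p q (z ′)) ⟩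
    ((z ′ ′ ⇒ p) ⇒ (q ⇒ z ′) ′) ′ ′     ≡⟨ involution _ ⟩
    (z ′ ′ ⇒ p) ⇒ (q ∧ z)               ≡⟨ cong (λ w → (w ⇒ p) ⇒ (q ∧ z)) (involution z) ⟩
    (z ⇒ p) ⇒ (q ∧ z)                   ∎

-- Order theory of an I₂₀-chain.

module Chain-Laws (A : Zroupoid) (isChain : IsI₂₀Chain A) where
  open Zroupoid A hiding (Carrier)
  open IsI₂₀Chain isChain using (isI₂₀; total)
  open IsI₂₀ isI₂₀ using (involution)
  open I₂₀-Laws A isI₂₀ public
  open ≡-Reasoning

  ∧-commutative : ∀ x y → x ∧ y ≡ y ∧ x
  ∧-commutative x y with total x y
  ... | inj₁ x⊑y = trans x⊑y (sym (∧-swap x⊑y))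
  ... | inj₂ y⊑x = trans (∧-swap y⊑x) (sym y⊑x)

  ∧-selective : ∀ x y → (x ∧ y ≡ x) ⊎ (x ∧ y ≡ y)
  ∧-selective x y with total x y
  ... | inj₁ x⊑y = inj₁ x⊑y
  ... | inj₂ y⊑x = inj₂ (∧-swap y⊑x)

  ⊑-refl : ∀ x → x ⊑ x
  ⊑-refl = ∧-idempotent

  ⊑-antisym : ∀ {x y} → x ⊑ y → y ⊑ x → x ≡ y
  ⊑-antisym {x} {y} x⊑y y⊑x = trans (sym x⊑y) (trans (∧-commutative x y) y⊑x)

  infixl 6 _∨_
  _∨_ : Carrier A → Carrier A → Carrier A
  x ∨ y = (x ′ ∧ y ′) ′

  ∨-commutative : ∀ x y → x ∨ y ≡ y ∨ x
  ∨-commutative x y = cong _′ (∧-commutative (x ′) (y ′))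

  ∨-selective : ∀ x y → (x ∨ y ≡ x) ⊎ (x ∨ y ≡ y)
  ∨-selective x y with ∧-selective (x ′) (y ′)
  ... | inj₁ eq = inj₁ (trans (cong _′ eq) (involution x))
  ... | inj₂ eq = inj₂ (trans (cong _′ eq) (involution y))

  ∨-as-⇒ : ∀ x y → x ∨ y ≡ x ′ ⇒ y
  ∨-as-⇒ x y = trans (involution _) (cong (x ′ ⇒_) (involution y))

  ∧-distrib-∨ : ∀ p q z → (p ∨ q) ∧ z ≡ (z ∧ p) ∨ (z ∧ q)
  ∧-distrib-∨ p q z = begin
    (p ∨ q) ∧ z          ≡⟨ cong (_∧ z) (∨-as-⇒ p q) ⟩
    (p ′ ⇒ q) ∧ z        ≡⟨ ⇒-∧ (p ′) q z ⟩
    (z ⇒ p ′) ⇒ (q ∧ z)  ≡⟨ cong₂ _⇒_ (sym (involution _)) (∧-commutative q z) ⟩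
    (z ∧ p) ′ ⇒ (z ∧ q)  ≡⟨ ∨-as-⇒ (z ∧ p) (z ∧ q) ⟨
    (z ∧ p) ∨ (z ∧ q)    ∎

  across : ∀ {p z q} → p ⊑ z → z ⊑ q → (p ∨ q) ∧ z ≡ p ∨ z
  across {p} {z} {q} p⊑z z⊑q =
    trans (∧-distrib-∨ p q z) (cong₂ _∨_ (trans (∧-commutative z p) p⊑z) z⊑q)

  -- Three elements forming a ⊑-cycle coincide; distributivity along the cycle
  -- propagates which of the two elements a ∨ c equals.
  cycle-collapses : ∀ {a b c} → a ⊑ b → b ⊑ c → c ⊑ a → a ≡ c
  cycle-collapses {a} {b} {c} a⊑b b⊑c c⊑a with ∨-selective a c
  ... | inj₁ a∨c≡a = begin
      a            ≡⟨ a∨c≡a ⟨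
      a ∨ c        ≡⟨ ∨-commutative a c ⟩
      c ∨ a        ≡⟨ across c⊑a a⊑b ⟨
      (c ∨ b) ∧ a  ≡⟨ cong (_∧ a) (trans (∨-commutative c b) b∨c≡c) ⟩
      c ∧ a        ≡⟨ c⊑a ⟩
      c            ∎
    where
      a∨b≡a : a ∨ b ≡ a
      a∨b≡a = trans (sym (across a⊑b b⊑c)) (trans (cong (_∧ b) a∨c≡a) a⊑b)
      b∨c≡c : b ∨ c ≡ c
      b∨c≡c = trans (sym (across b⊑c c⊑a))
                (trans (cong (_∧ c) (trans (∨-commutative b a) a∨b≡a)) (trans (∧-commutative a c) c⊑a))
  ... | inj₂ a∨c≡c = begin
      a            ≡⟨ trans (∧-commutative b a) a⊑b ⟨
      b ∧ a        ≡⟨ cong (_∧ a) (trans (∨-commutative c b) b∨c≡b) ⟨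
      (c ∨ b) ∧ a  ≡⟨ across c⊑a a⊑b ⟩
      c ∨ a        ≡⟨ ∨-commutative c a ⟩
      a ∨ c        ≡⟨ a∨c≡c ⟩
      c            ∎
    where
      a∨b≡b : a ∨ b ≡ b
      a∨b≡b = trans (sym (across a⊑b b⊑c)) (trans (cong (_∧ b) a∨c≡c) (trans (∧-commutative c b) b⊑c))
      b∨c≡b : b ∨ c ≡ b
      b∨c≡b = trans (sym (across b⊑c c⊑a)) (trans (cong (_∧ c) (trans (∨-commutative b a) a∨b≡b)) b⊑c)

  -- A failure of transitivity would be a ⊑-cycle.
  ⊑-trans : ∀ {a b c} → a ⊑ b → b ⊑ c → a ⊑ c
  ⊑-trans {a} {b} {c} a⊑b b⊑c with total a c
  ... | inj₁ a⊑c = a⊑c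
  ... | inj₂ c⊑a = subst (a ⊑_) (cycle-collapses a⊑b b⊑c c⊑a) (⊑-refl a)

  -- (x′ ∧ z)′ is the join of x and z′, so this says joins are monotone.
  join-monotone : ∀ {x y} → x ⊑ y → ∀ z → ((x ′ ∧ z) ′) ⊑ ((y ′ ∧ z) ′)
  join-monotone {x} {y} x⊑y z = sym (begin
      (x ′ ∧ z) ′                ≡⟨ cong (λ w → (w ∧ z) ′) x′∨y′≡x′ ⟨
      ((x ′ ∨ y ′) ∧ z) ′        ≡⟨ cong _′ (∧-distrib-∨ (x ′) (y ′) z) ⟩
      ((z ∧ x ′) ∨ (z ∧ y ′)) ′  ≡⟨ involution _ ⟩
      (z ∧ x ′) ′ ∧ (z ∧ y ′) ′  ≡⟨ cong₂ (λ u v → u ′ ∧ v ′)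
                                        (∧-commutative z (x ′)) (∧-commutative z (y ′)) ⟩
      (x ′ ∧ z) ′ ∧ (y ′ ∧ z) ′  ∎)
    where
      x′∨y′≡x′ : x ′ ∨ y ′ ≡ x ′
      x′∨y′≡x′ = trans (cong₂ (λ u v → (u ∧ v) ′) (involution x) (involution y)) (cong _′ x⊑y)

  join-𝟎 : ∀ z → (𝟎 ′ ∧ z) ′ ≡ z ′
  join-𝟎 z = cong _′ (𝟏-∧ z)

  join-below : ∀ {x z} → x ⊑ z → (x ′ ′ ∧ z) ′ ≡ x ′
  join-below {x} x⊑z = cong _′ (trans (cong (_∧ _) (involution x)) x⊑z)

  ′-antitone-when : ∀ {x z} → 𝟎 ⊑ (x ′) → x ⊑ z → (z ′) ⊑ (x ′)
  ′-antitone-when {x} {z} 𝟎⊑x′ x⊑z =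
    subst₂ _⊑_ (join-𝟎 z) (join-below x⊑z) (join-monotone 𝟎⊑x′ z)

  ′-monotone-when : ∀ {x z} → (x ′) ⊑ 𝟎 → x ⊑ z → (x ′) ⊑ (z ′)
  ′-monotone-when {x} {z} x′⊑𝟎 x⊑z =
    subst₂ _⊑_ (join-below x⊑z) (join-𝟎 z) (join-monotone x′⊑𝟎 z)

  ′-preserves-above : ∀ {x} → 𝟎 ⊑ x → 𝟎 ⊑ (x ′)
  ′-preserves-above {x} 𝟎⊑x with total 𝟎 (x ′)
  ... | inj₁ 𝟎⊑x′ = 𝟎⊑x′
  ... | inj₂ x′⊑𝟎 =
    subst (λ w → 𝟎 ⊑ (w ′)) (sym x≡𝟏) (subst (𝟎 ⊑_) (sym (involution 𝟎)) (⊑-refl 𝟎))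
    where
      𝟏⊑x : 𝟏 ⊑ x
      𝟏⊑x = subst (𝟏 ⊑_) (involution x)
              (′-antitone-when {x ′} (subst (𝟎 ⊑_) (sym (involution x)) 𝟎⊑x) x′⊑𝟎)
      x≡𝟏 : x ≡ 𝟏
      x≡𝟏 = ⊑-antisym (∧-𝟏 x) 𝟏⊑x

  ′-antitone : ∀ {x z} → 𝟎 ⊑ x → x ⊑ z → (z ′) ⊑ (x ′)
  ′-antitone 𝟎⊑x = ′-antitone-when (′-preserves-above 𝟎⊑x)

  -- An element outside the up-set of 0 lies below 0, and so does its negation …
  below-𝟎 : ∀ {x} → ¬ (𝟎 ⊑ x) → x ⊑ 𝟎
  below-𝟎 {x} 𝟎⋢x with total 𝟎 x
  ... | inj₁ 𝟎⊑x = ⊥-elim (𝟎⋢x 𝟎⊑x)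
  ... | inj₂ x⊑𝟎 = x⊑𝟎

  ′-below-𝟎 : ∀ {x} → ¬ (𝟎 ⊑ x) → (x ′) ⊑ 𝟎
  ′-below-𝟎 {x} 𝟎⋢x with total 𝟎 (x ′)
  ... | inj₁ 𝟎⊑x′ = ⊥-elim (𝟎⋢x (subst (𝟎 ⊑_) (involution x) (′-preserves-above 𝟎⊑x′)))
  ... | inj₂ x′⊑𝟎 = x′⊑𝟎

  -- … so ′ preserves the order between x and x′, which forces x′ = x.
  ′-fixes-below : ∀ {x} → ¬ (𝟎 ⊑ x) → x ′ ≡ x
  ′-fixes-below {x} 𝟎⋢x with total x (x ′)
  ... | inj₁ x⊑x′ =
    ⊑-antisym (subst ((x ′) ⊑_) (involution x) (′-monotone-when (′-below-𝟎 𝟎⋢x) x⊑x′)) x⊑x′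
  ... | inj₂ x′⊑x = ⊑-antisym x′⊑x (subst (_⊑ (x ′)) (involution x)
      (′-monotone-when (subst (_⊑ 𝟎) (sym (involution x)) (below-𝟎 𝟎⋢x)) x′⊑x))

  infix 4 _⊏_
  _⊏_ : Carrier A → Carrier A → Set
  x ⊏ y = x ⊑ y × x ≢ y

  ⊏-trans : ∀ {x y z} → x ⊏ y → y ⊏ z → x ⊏ z
  ⊏-trans (x⊑y , _) (y⊑z , y≢z) =
    ⊑-trans x⊑y y⊑z , λ x≡z → y≢z (⊑-antisym y⊑z (subst (_⊑ _) x≡z x⊑y))

module Isomorphism {A B : Zroupoid} (φ : A ≅ B) where
  open _≅_ φ
  open Zroupoid A using () renaming (_⇒_ to _⇒ᴬ_; 𝟎 to 𝟎ᴬ; _′ to _′ᴬ; _⊑_ to _⊑ᴬ_)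
  open Zroupoid B using () renaming (_⇒_ to _⇒ᴮ_; 𝟎 to 𝟎ᴮ; _′ to _′ᴮ; _⊑_ to _⊑ᴮ_)

  to-injective : ∀ {x y} → to x ≡ to y → x ≡ y
  to-injective = Injection.injective (↔⇒↣ bij)

  to-′ : ∀ x → to (x ′ᴬ) ≡ (to x) ′ᴮ
  to-′ x = trans (hom-⇒ x 𝟎ᴬ) (cong (to x ⇒ᴮ_) hom-𝟎)

  to-⊑ : ∀ {x y} → x ⊑ᴬ y → to x ⊑ᴮ to y
  to-⊑ {x} {y} x⊑y = trans (sym to-meet) (cong to x⊑y)
    where
      to-meet : to ((x ⇒ᴬ y ′ᴬ) ′ᴬ) ≡ (to x ⇒ᴮ (to y) ′ᴮ) ′ᴮ
      to-meet = trans (to-′ _) (cong _′ᴮ (trans (hom-⇒ x (y ′ᴬ)) (cong (to x ⇒ᴮ_) (to-′ y))))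

module Twist (N m : ℕ) where

  g : ℕ → ℕ
  g x with x <? m
  ... | yes _ = x
  ... | no  _ = m + (N ∸ x)

  imp : ℕ → ℕ → ℕ
  imp a b = g (a ⊓ g b)

  g-below : ∀ {x} → x < m → g x ≡ x
  g-below {x} x<m with x <? m
  ... | yes _   = refl
  ... | no  x≮m = ⊥-elim (x≮m x<m)

  g-above : ∀ {x} → m ≤ x → g x ≡ m + (N ∸ x)
  g-above {x} m≤x with x <? m
  ... | yes x<m = ⊥-elim (<⇒≱ x<m m≤x)
  ... | no  _   = refl

  g-stays-above : ∀ {x} → m ≤ x → m ≤ g x
  g-stays-above {x} m≤x = subst (m ≤_) (sym (g-above m≤x)) (m≤m+n m (N ∸ x))

  g-antitone : ∀ {x y} → m ≤ x → x ≤ y → g y ≤ g x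
  g-antitone {x} {y} m≤x x≤y =
    subst₂ _≤_ (sym (g-above (≤-trans m≤x x≤y))) (sym (g-above m≤x)) (+-monoʳ-≤ m (∸-monoʳ-≤ N x≤y))

  g-bounded : ∀ {x} → x ≤ N → g x ≤ N
  g-bounded {x} x≤N with x <? m
  ... | yes _   = x≤N
  ... | no  x≮m = ≤-trans (+-monoˡ-≤ (N ∸ x) (≮⇒≥ x≮m)) (≤-reflexive (m+[n∸m]≡n x≤N))

  g-involutive : ∀ {x} → x ≤ N → g (g x) ≡ x
  g-involutive {x} x≤N with x <? m
  ... | yes x<m = g-below x<m
  ... | no  x≮m = begin
      g (m + (N ∸ x))        ≡⟨ g-above (m≤m+n m (N ∸ x)) ⟩
      m + (N ∸ (m + (N ∸ x))) ≡⟨ cong (λ w → m + (N ∸ w)) (+-comm m (N ∸ x)) ⟩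
      m + (N ∸ ((N ∸ x) + m)) ≡⟨ cong (m +_) (∸-+-assoc N (N ∸ x) m) ⟨
      m + (N ∸ (N ∸ x) ∸ m)   ≡⟨ cong (λ w → m + (w ∸ m)) (m∸[m∸n]≡n x≤N) ⟩
      m + (x ∸ m)             ≡⟨ m+[n∸m]≡n (≮⇒≥ x≮m) ⟩
      x                       ∎
    where open ≡-Reasoning

  g-m : m ≤ N → g m ≡ N
  g-m m≤N = trans (g-above ≤-refl) (m+[n∸m]≡n m≤N)

  meet-image-below : ∀ {u} w → u < m → g (g u ⊓ w) ≡ u ⊓ w
  meet-image-below {u} w u<m =
    trans (cong (λ x → g (x ⊓ w)) (g-below u<m)) (g-below (≤-<-trans (m⊓n≤m u w) u<m))

  meet-image-small : ∀ {u w} → m ≤ u → w < m → g (g u ⊓ w) ≡ w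
  meet-image-small {u} {w} m≤u w<m =
    trans (cong g (m≥n⇒m⊓n≡n (≤-trans (<⇒≤ w<m) (g-stays-above m≤u)))) (g-below w<m)

  meet-stays-above : ∀ {u w} → m ≤ u → m ≤ w → m ≤ g u ⊓ w
  meet-stays-above m≤u m≤w = ⊓-glb (g-stays-above m≤u) m≤w

  -- The key inequality behind identity (I): u ↦ g (g u ⊓ w) is monotone.
  g-meet-monotone : ∀ {u v} w → u ≤ v → g (g u ⊓ w) ≤ g (g v ⊓ w)
  g-meet-monotone {u} {v} w u≤v with ≤-<-connex m u | ≤-<-connex m v | ≤-<-connex m w
  ... | inj₂ u<m | inj₂ v<m | _ =
    subst₂ _≤_ (sym (meet-image-below w u<m)) (sym (meet-image-below w v<m)) (⊓-monoˡ-≤ w u≤v)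
  ... | inj₂ u<m | inj₁ m≤v | inj₂ w<m =
    subst₂ _≤_ (sym (meet-image-below w u<m)) (sym (meet-image-small m≤v w<m)) (m⊓n≤n u w)
  ... | inj₂ u<m | inj₁ m≤v | inj₁ m≤w =
    subst (_≤ _) (sym (meet-image-below w u<m))
      (≤-trans (<⇒≤ (≤-<-trans (m⊓n≤m u w) u<m)) (g-stays-above (meet-stays-above m≤v m≤w)))
  ... | inj₁ m≤u | inj₂ v<m | _ = ⊥-elim (<⇒≱ v<m (≤-trans m≤u u≤v))
  ... | inj₁ m≤u | inj₁ m≤v | inj₂ w<m =
    ≤-reflexive (trans (meet-image-small m≤u w<m) (sym (meet-image-small m≤v w<m)))
  ... | inj₁ m≤u | inj₁ m≤v | inj₁ m≤w =
    g-antitone (meet-stays-above m≤v m≤w) (⊓-monoˡ-≤ w (g-antitone m≤u u≤v))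

  imp-bounded : ∀ {a} b → a ≤ N → imp a b ≤ N
  imp-bounded {a} b a≤N = g-bounded (≤-trans (m⊓n≤m a (g b)) a≤N)

  imp-m : m ≤ N → ∀ {a} → a ≤ N → imp a m ≡ g a
  imp-m m≤N {a} a≤N = cong g (trans (cong (a ⊓_) (g-m m≤N)) (m≤n⇒m⊓n≡m a≤N))

  meet-law : ∀ {a b} → a ≤ N → b ≤ N → g (imp a (g b)) ≡ a ⊓ b
  meet-law {a} {b} a≤N b≤N =
    trans (cong (λ w → g (g (a ⊓ w))) (g-involutive b≤N)) (g-involutive (≤-trans (m⊓n≤m a b) a≤N))

  -- Identity (I), after simplification of its right-hand side.
  identity-law : ∀ a {b} c → b ≤ N → imp (imp a b) c ≡ imp (g c) a ⊓ imp b c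
  identity-law a {b} c b≤N with ≤-total a (g b)
  ... | inj₁ a≤gb = begin
      g (g (a ⊓ g b) ⊓ g c)      ≡⟨ cong (λ w → g (g w ⊓ g c)) (m≤n⇒m⊓n≡m a≤gb) ⟩
      g (g a ⊓ g c)              ≡⟨ cong g (⊓-comm (g a) (g c)) ⟩
      imp (g c) a                ≡⟨ m≤n⇒m⊓n≡m (subst (λ w → imp (g c) a ≤ g (w ⊓ g c))
                                                  (g-involutive b≤N) lhs≤rhs) ⟨
      imp (g c) a ⊓ imp b c      ∎
    where
      open ≡-Reasoning
      lhs≤rhs : imp (g c) a ≤ g (g (g b) ⊓ g c)
      lhs≤rhs = subst (_≤ _) (cong g (⊓-comm (g a) (g c))) (g-meet-monotone (g c) a≤gb)
  ... | inj₂ gb≤a = begin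
      g (g (a ⊓ g b) ⊓ g c)      ≡⟨ cong (λ w → g (g w ⊓ g c)) (m≥n⇒m⊓n≡n gb≤a) ⟩
      g (g (g b) ⊓ g c)          ≡⟨ cong (λ w → g (w ⊓ g c)) (g-involutive b≤N) ⟩
      imp b c                    ≡⟨ m≥n⇒m⊓n≡n rhs≤lhs ⟨
      imp (g c) a ⊓ imp b c      ∎
    where
      open ≡-Reasoning
      rhs≤lhs : imp b c ≤ imp (g c) a
      rhs≤lhs = subst₂ _≤_ (cong (λ w → g (w ⊓ g c)) (g-involutive b≤N)) (cong g (⊓-comm (g a) (g c)))
                  (g-meet-monotone (g c) gb≤a)

-- The standard chain C(N, m).

standard : ℕ → ℕ → Zroupoid
standard N m = record
  { Carrier = Fin (suc N)
  ; _⇒_     = λ x y → Twist.imp N m (toℕ x) (toℕ y) mod suc N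
  ; 𝟎       = m mod suc N
  }

module Standard {N m : ℕ} (m≤N : m ≤ N) where
  open Zroupoid (standard N m) hiding (Carrier)
  open Twist N m
  open ≡-Reasoning

  toℕ-⇒ : ∀ x y → toℕ (x ⇒ y) ≡ imp (toℕ x) (toℕ y)
  toℕ-⇒ x y = toℕ-mod (imp-bounded (toℕ y) (toℕ≤pred[n] x))

  toℕ-′ : ∀ x → toℕ (x ′) ≡ g (toℕ x)
  toℕ-′ x = trans (toℕ-⇒ x 𝟎) (trans (cong (imp (toℕ x)) (toℕ-mod m≤N)) (imp-m m≤N (toℕ≤pred[n] x)))

  toℕ-∧ : ∀ x y → toℕ ((x ⇒ y ′) ′) ≡ toℕ x ⊓ toℕ y
  toℕ-∧ x y = begin
    toℕ ((x ⇒ y ′) ′)          ≡⟨ toℕ-′ _ ⟩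
    g (toℕ (x ⇒ y ′))          ≡⟨ cong g (toℕ-⇒ x (y ′)) ⟩
    g (imp (toℕ x) (toℕ (y ′))) ≡⟨ cong (λ w → g (imp (toℕ x) w)) (toℕ-′ y) ⟩
    g (imp (toℕ x) (g (toℕ y))) ≡⟨ meet-law (toℕ≤pred[n] x) (toℕ≤pred[n] y) ⟩
    toℕ x ⊓ toℕ y              ∎

  ⊑⇒≤ : ∀ {x y} → x ⊑ y → toℕ x ≤ toℕ y
  ⊑⇒≤ {x} {y} x⊑y = m⊓n≡m⇒m≤n (trans (sym (toℕ-∧ x y)) (cong toℕ x⊑y))

  ≤⇒⊑ : ∀ {x y} → toℕ x ≤ toℕ y → x ⊑ y
  ≤⇒⊑ {x} {y} x≤y = toℕ-injective (trans (toℕ-∧ x y) (m≤n⇒m⊓n≡m x≤y))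

  involutive : ∀ x → x ′ ′ ≡ x
  involutive x = toℕ-injective
    (trans (toℕ-′ (x ′)) (trans (cong g (toℕ-′ x)) (g-involutive (toℕ≤pred[n] x))))

  satisfies-I : ∀ x y z → (x ⇒ y) ⇒ z ≡ ((z ′ ⇒ x) ⇒ (y ⇒ z) ′) ′
  satisfies-I x y z = toℕ-injective (begin
      toℕ ((x ⇒ y) ⇒ z)                     ≡⟨ trans (toℕ-⇒ _ z) (cong (λ w → imp w c) (toℕ-⇒ x y)) ⟩
      imp (imp a b) c                        ≡⟨ identity-law a c (toℕ≤pred[n] y) ⟩
      imp (g c) a ⊓ imp b c                  ≡⟨ meet-law (imp-bounded a (g≤ z)) (imp-bounded c (toℕ≤pred[n] y)) ⟨
      g (imp (imp (g c) a) (g (imp b c)))    ≡⟨ cong g (cong₂ imp left right) ⟨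
      g (imp (toℕ (z ′ ⇒ x)) (toℕ ((y ⇒ z) ′))) ≡⟨ cong g (toℕ-⇒ _ _) ⟨
      g (toℕ ((z ′ ⇒ x) ⇒ (y ⇒ z) ′))        ≡⟨ toℕ-′ _ ⟨
      toℕ (((z ′ ⇒ x) ⇒ (y ⇒ z) ′) ′)        ∎)
    where
      a b c : ℕ
      a = toℕ x
      b = toℕ y
      c = toℕ z
      g≤ : ∀ w → g (toℕ w) ≤ N
      g≤ w = g-bounded (toℕ≤pred[n] w)
      left : toℕ (z ′ ⇒ x) ≡ imp (g c) a
      left = trans (toℕ-⇒ _ x) (cong (λ w → imp w a) (toℕ-′ z))
      right : toℕ ((y ⇒ z) ′) ≡ g (imp b c)
      right = trans (toℕ-′ _) (cong g (toℕ-⇒ y z))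

  isChain : IsI₂₀Chain (standard N m)
  isChain = record
    { isI₂₀ = record
      { isImplicationZroupoid = record { identityI = satisfies-I ; zero′′ = involutive 𝟎 }
      ; involution            = involutive }
    ; total = λ x y → ⊎-map ≤⇒⊑ ≤⇒⊑ (≤-total (toℕ x) (toℕ y)) }

standard-rigid : ∀ {N m m′} → m ≤ N → m′ ≤ N → standard N m ≅ standard N m′ → m ≡ m′
standard-rigid {N} {m} {m′} m≤N m′≤N φ = begin
    m                        ≡⟨ to-is-id m m≤N ⟨
    toℕ (to (m mod suc N))   ≡⟨ cong toℕ hom-𝟎 ⟩
    toℕ (m′ mod suc N)       ≡⟨ toℕ-mod m′≤N ⟩
    m′                       ∎
  where
    open ≡-Reasoning
    open _≅_ φ using (to; hom-𝟎)
    open Isomorphism φ using (to-injective; to-⊑)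
    module C  = Standard m≤N
    module C′ = Standard m′≤N
    h : ℕ → ℕ
    h k = toℕ (to (k mod suc N))
    h-increasing : ∀ k → k < N → h k < h (suc k)
    h-increasing k k<N = ≤∧≢⇒< (C′.⊑⇒≤ (to-⊑ (C.≤⇒⊑ k≤1+k))) λ eq → 1+n≢n (sym (k≡1+k eq))
      where
        k≤1+k : toℕ (k mod suc N) ≤ toℕ (suc k mod suc N)
        k≤1+k = subst₂ _≤_ (sym (toℕ-mod (<⇒≤ k<N))) (sym (toℕ-mod k<N)) (n≤1+n k)
        k≡1+k : h k ≡ h (suc k) → k ≡ suc k
        k≡1+k eq = trans (sym (toℕ-mod (<⇒≤ k<N)))
                     (trans (cong toℕ (to-injective (toℕ-injective eq))) (toℕ-mod k<N))
    to-is-id : ∀ k → k ≤ N → h k ≡ k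
    to-is-id = increasing-self-map-is-id h h-increasing (λ k _ → toℕ≤pred[n] (to (k mod suc N)))

-- Every I₂₀-chain with N + 1 elements is isomorphic to C(N, rank 0), where the
-- rank of x is the number of elements strictly below it.

module Ranking {N : ℕ} (A : Zroupoid) (isChain : IsI₂₀Chain A) (e : Carrier A ↔ Fin (suc N)) where
  open Zroupoid A hiding (Carrier)
  open IsI₂₀Chain isChain using (total)
  open Chain-Laws A isChain
  open Inverse e using (to; from; strictlyInverseˡ; strictlyInverseʳ)
  open ≡-Reasoning

  _≟ᴬ_ : (x y : Carrier A) → Dec (x ≡ y)
  x ≟ᴬ y = map′ (Injection.injective (↔⇒↣ e)) (cong to) (to x ≟ᶠ to y)

  _⊏?_ : (x y : Carrier A) → Dec (x ⊏ y)
  x ⊏? y = ((x ∧ y) ≟ᴬ x) ×-dec ¬? (x ≟ᴬ y)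

  below : Carrier A → Subset (suc N)
  below x = tabulate (λ j → isYes (from j ⊏? x))

  rank : Carrier A → ℕ
  rank x = ∣ below x ∣

  lookup-below : ∀ j x → lookup (below x) j ≡ isYes (from j ⊏? x)
  lookup-below j x = lookup∘tabulate (λ i → isYes (from i ⊏? x)) j

  ∈-below⁻ : ∀ {j x} → j ∈ below x → from j ⊏ x
  ∈-below⁻ {j} {x} j∈ = toWitness {a? = from j ⊏? x}
    (Equivalence.from T-≡ (trans (sym (lookup-below j x)) ([]=⇒lookup j∈)))

  ∈-below⁺ : ∀ {j x} → from j ⊏ x → j ∈ below x
  ∈-below⁺ {j} {x} j⊏x = lookup⇒[]= j (below x)
    (trans (lookup-below j x) (Equivalence.to T-≡ (fromWitness {a? = from j ⊏? x} j⊏x)))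

  position-below : ∀ {x y} → x ⊏ y → to x ∈ below y
  position-below {x} {y} x⊏y = ∈-below⁺ (subst (_⊏ y) (sym (strictlyInverseʳ x)) x⊏y)

  position-not-below : ∀ x → ¬ (to x ∈ below x)
  position-not-below x to-x∈ = proj₂ (subst (_⊏ x) (strictlyInverseʳ x) (∈-below⁻ to-x∈)) refl

  -- rank is strictly monotone, and below N since x's own position is not below x.
  rank-strict : ∀ {x y} → x ⊏ y → rank x < rank y
  rank-strict {x} {y} x⊏y = p⊂q⇒∣p∣<∣q∣
    ((λ j∈ → ∈-below⁺ (⊏-trans (∈-below⁻ j∈) x⊏y)) , to x , position-below x⊏y , position-not-below x)

  rank-bounded : ∀ x → rank x ≤ N
  rank-bounded x = s≤s⁻¹ (subst (rank x <_) (∣⊤∣≡n (suc N))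
    (p⊂q⇒∣p∣<∣q∣ (⊆⊤ , to x , ∈⊤ , position-not-below x)))

  rank-monotone : ∀ {x y} → x ⊑ y → rank x ≤ rank y
  rank-monotone {x} {y} x⊑y with x ≟ᴬ y
  ... | yes refl = ≤-refl
  ... | no  x≢y  = <⇒≤ (rank-strict (x⊑y , x≢y))

  rank-reflects-⊑ : ∀ {x y} → rank x ≤ rank y → x ⊑ y
  rank-reflects-⊑ {x} {y} rx≤ry with total x y
  ... | inj₁ x⊑y = x⊑y
  ... | inj₂ y⊑x with y ≟ᴬ x
  ...   | yes refl = ⊑-refl x
  ...   | no  y≢x  = ⊥-elim (<⇒≱ (rank-strict (y⊑x , y≢x)) rx≤ry)

  rank-reflects-⊏ : ∀ {x y} → rank x < rank y → x ⊏ y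
  rank-reflects-⊏ rx<ry = rank-reflects-⊑ (<⇒≤ rx<ry) , λ x≡y → <⇒≢ rx<ry (cong rank x≡y)

  rank-injective : ∀ {x y} → rank x ≡ rank y → x ≡ y
  rank-injective eq = ⊑-antisym (rank-reflects-⊑ (≤-reflexive eq)) (rank-reflects-⊑ (≤-reflexive (sym eq)))

  rankFin : Carrier A → Fin (suc N)
  rankFin x = rank x mod suc N

  toℕ-rankFin : ∀ x → toℕ (rankFin x) ≡ rank x
  toℕ-rankFin x = toℕ-mod (rank-bounded x)

  rankFin-injective : ∀ {x y} → rankFin x ≡ rankFin y → x ≡ y
  rankFin-injective {x} {y} eq =
    rank-injective (trans (sym (toℕ-rankFin x)) (trans (cong toℕ eq) (toℕ-rankFin y)))

  from-injective : ∀ {i i′} → from i ≡ from i′ → i ≡ i′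
  from-injective {i} {i′} eq = trans (sym (strictlyInverseˡ i)) (trans (cong to eq) (strictlyInverseˡ i′))

  -- By pigeonhole, every rank is attained.
  rankFin-surjective : ∀ j → ∃ λ x → rankFin x ≡ j
  rankFin-surjective j
    with injective⇒surjective (λ i → rankFin (from i)) (λ eq → from-injective (rankFin-injective eq)) j
  ... | i , eq = from i , eq

  element : Fin (suc N) → Carrier A
  element j = proj₁ (rankFin-surjective j)

  rank-element : ∀ {k} → k ≤ N → rank (element (k mod suc N)) ≡ k
  rank-element {k} k≤N = begin
    rank (element j)          ≡⟨ toℕ-rankFin (element j) ⟨
    toℕ (rankFin (element j)) ≡⟨ cong toℕ (proj₂ (rankFin-surjective j)) ⟩
    toℕ j                     ≡⟨ toℕ-mod k≤N ⟩
    k                         ∎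
    where
      j : Fin (suc N)
      j = k mod suc N

  ranking : Carrier A ↔ Fin (suc N)
  ranking = mk↔ₛ′ rankFin element (λ j → proj₂ (rankFin-surjective j))
                  (λ x → rankFin-injective (proj₂ (rankFin-surjective (rankFin x))))

  open Twist N (rank 𝟎)

  negatedRank : ℕ → ℕ
  negatedRank k = rank (element (k mod suc N) ′)

  above-𝟎 : ∀ {k} → rank 𝟎 ≤ k → k ≤ N → 𝟎 ⊑ element (k mod suc N)
  above-𝟎 𝟎≤k k≤N = rank-reflects-⊑ (subst (rank 𝟎 ≤_) (sym (rank-element k≤N)) 𝟎≤k)

  negatedRank-decreasing : ∀ k → rank 𝟎 ≤ k → k < N → negatedRank (suc k) < negatedRank k
  negatedRank-decreasing k 𝟎≤k k<N =
    rank-strict (′-antitone (above-𝟎 𝟎≤k (<⇒≤ k<N)) (proj₁ x⊏y) ,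
                 λ eq → proj₂ x⊏y (sym (′-injective eq)))
    where
      x⊏y : element (k mod suc N) ⊏ element (suc k mod suc N)
      x⊏y = rank-reflects-⊏ (subst₂ _<_ (sym (rank-element (<⇒≤ k<N))) (sym (rank-element k<N)) ≤-refl)

  negatedRank-range : ∀ k → rank 𝟎 ≤ k → k ≤ N → rank 𝟎 ≤ negatedRank k × negatedRank k ≤ N
  negatedRank-range k 𝟎≤k k≤N = rank-monotone (′-preserves-above (above-𝟎 𝟎≤k k≤N)) , rank-bounded _

  rank-′-above : ∀ {a} → 𝟎 ⊑ a → rank (a ′) ≡ rank 𝟎 + (N ∸ rank a)
  rank-′-above {a} 𝟎⊑a = begin
    rank (a ′)              ≡⟨ cong (λ w → rank (w ′)) (rank-injective (sym (rank-element (rank-bounded a)))) ⟩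
    negatedRank (rank a)    ≡⟨ decreasing-self-map-is-reflection negatedRank negatedRank-decreasing
                                 negatedRank-range (rank a) (rank-monotone 𝟎⊑a) (rank-bounded a) ⟩
    rank 𝟎 + (N ∸ rank a)   ∎

  rank-′ : ∀ a → rank (a ′) ≡ g (rank a)
  rank-′ a with (𝟎 ∧ a) ≟ᴬ 𝟎
  ... | yes 𝟎⊑a = trans (rank-′-above 𝟎⊑a) (sym (g-above (rank-monotone 𝟎⊑a)))
  ... | no  𝟎⋢a = trans (cong rank (′-fixes-below 𝟎⋢a))
                        (sym (g-below (≰⇒> (λ le → 𝟎⋢a (rank-reflects-⊑ le)))))

  rank-∧ : ∀ a b → rank (a ∧ b) ≡ rank a ⊓ rank b
  rank-∧ a b with ∧-selective a b
  ... | inj₁ a∧b≡a = trans (cong rank a∧b≡a) (sym (m≤n⇒m⊓n≡m (rank-monotone a∧b≡a)))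
  ... | inj₂ a∧b≡b =
    trans (cong rank a∧b≡b) (sym (m≥n⇒m⊓n≡n (rank-monotone (trans (∧-commutative b a) a∧b≡b))))

  rank-⇒ : ∀ a b → rank (a ⇒ b) ≡ imp (rank a) (rank b)
  rank-⇒ a b = begin
    rank (a ⇒ b)             ≡⟨ cong rank (⇒-via-∧ a b) ⟩
    rank ((a ∧ b ′) ′)        ≡⟨ rank-′ _ ⟩
    g (rank (a ∧ b ′))        ≡⟨ cong g (rank-∧ a (b ′)) ⟩
    g (rank a ⊓ rank (b ′))   ≡⟨ cong (λ w → g (rank a ⊓ w)) (rank-′ b) ⟩
    imp (rank a) (rank b)     ∎

  classification : A ≅ standard N (rank 𝟎)
  classification = record
    { bij   = ranking
    ; hom-⇒ = λ x y → cong (_mod suc N)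
                (trans (rank-⇒ x y) (sym (cong₂ imp (toℕ-rankFin x) (toℕ-rankFin y))))
    ; hom-𝟎 = refl
    }

theorem5p14 : (n : ℕ) → NonZero n →
    Σ (Fin n → Zroupoid) λ C →
    (∀ i → (Carrier (C i) ↔ Fin n)) ×
    (∀ i → IsI₂₀Chain (C i)) ×
    (∀ i j → C i ≅ C j → i ≡ j) ×
    ((A : Zroupoid) → (Carrier A ↔ Fin n) → IsI₂₀Chain A →
    ∃ λ i → A ≅ C i)
theorem5p14 zero ()
theorem5p14 (suc N) _ =
  C , (λ _ → ↔-id _) , (λ i → Standard.isChain (toℕ≤pred[n] i)) , non-isomorphic , exhaustive
  where
    C : Fin (suc N) → Zroupoid
    C i = standard N (toℕ i)
    non-isomorphic : ∀ i j → C i ≅ C j → i ≡ j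
    non-isomorphic i j φ = toℕ-injective (standard-rigid (toℕ≤pred[n] i) (toℕ≤pred[n] j) φ)
    exhaustive : (A : Zroupoid) → (Carrier A ↔ Fin (suc N)) → IsI₂₀Chain A → ∃ λ i → A ≅ C i
    exhaustive A e isChain =
      rankFin 𝟎 , subst (λ k → A ≅ standard N k) (sym (toℕ-rankFin 𝟎)) classification
      where
        open Ranking A isChain e
        open Zroupoid A using (𝟎)
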